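{- Let $c\in\mathbb{L}$, let $A\subseteq\mathbb{L}\setminus\{c\}$ be $c$-universal, and let $g\colon\mathbb{L}\to\mathbb{L}$ behave as $\widetilde{\mathrm{rer}}_c$ on $A$. Then $\{g\}\cup\mathrm{Aut}(\mathbb{L};C)$ generates every function $\mathbb{L}\to\mathbb{L}$ that preserves $\prec$ and has behavior $\mathrm{lin}$ on $\mathbb{L}$.
   Context: A finite rooted binary tree is a finite rooted tree in which every non-leaf vertex has exactly two children; its leaf structure is the structure on its set of leaves with the ternary relation $C$ where $C(x;yz)$ holds iff the youngest common ancestor of $y$ and $z$ is a proper descendant of the youngest common ancestor of $x,y,z$ (so $C(x;yy)$ holds whenever $x\neq y$). $(\mathbb{L};C)$ denotes the unique (up to isomorphism) countable homogeneous structure whose finite substructures are, up to isomorphism, exactly the leaf structures of finite rooted binary trees. We write $xy|z$ for $C(z;xy)$; $a_1\dots a_m|b_1\dots b_n$ (resp. $Y|Z$ for sets) means $a_ia_j|b_k$ and $b_kb_l|a_i$ for all $i,j,k,l$ (resp. all choices from $Y,Z$). $\prec$ is a fixed linear order on $\mathbb{L}$ that is convex (whenever $xy|z$, $z$ does not lie strictly between $x$ and $y$) and such that $(\mathbb{L};C,\prec)$ is homogeneous. Behavior $\mathrm{lin}$: $x\prec y\prec z$ implies $e(y)e(z)|e(x)$. A set $A\subseteq\mathbb{L}\setminus\{c\}$ is $c$-universal if for every finite $U\subset\mathbb{L}$ and $u\in U$ there is $\alpha\in\mathrm{Aut}(\mathbb{L};C)$ with $\alpha(u)=c$ and $\alpha(U)\subseteq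 A\cup\{c\}$. For $x\neq c$, $S^c_x=\{y\in\mathbb{L}\setminus\{c\}:xy|c\}$. $e$ preserves $C$ on $B$ if $C(x;yz)$ implies $C(e(x);e(y)e(z))$ for $x,y,z\in B$. $e$ behaves as $\widetilde{\mathrm{rer}}_c$ on $A$ if (1) $e(c)|e(A\cap S^c_a)$ for every $a\in A$, (2) $e$ preserves $C$ on $A\cap S^c_a$ for every $a\in A$, (3) for all $a,b\in A$ either $S^c_a=S^c_b$ or $e(A\cap S^c_a)|e(A\cap S^c_b)$, and (4) for all $x,y\in A$ with $x|yc$ we have $e(y)|e(x)e(c)$. $F\subseteq\mathbb{L}^{\mathbb{L}}$ generates $h$ if for every finite $A'\subseteq\mathbb{L}$ some finite composition of members of $F$ agrees with $h$ on $A'$. -}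

module Defs where

open import Data.Nat using (ℕ; _≥_)
open import Data.Fin using (Fin)
open import Data.Bool using (Bool; true; false)
open import Data.Empty using (⊥)
open import Data.Unit using (⊤)
open import Data.Product using (Σ; ∃; _×_; _,_)
open import Data.Sum using (_⊎_)
open import Relation.Nullary using (¬_)
open import Relation.Binary.PropositionalEquality using (_≡_; _≢_)
open import Function using (_∘_)
open import Function.Definitions using (Injective; Bijective)

data Tree : Set where
  leaf : Tree
  node : Tree → Tree → Tree

data Leaf : Tree → Set where
  here  : Leaf leaf
  left  : ∀ {l r} → Leaf l → Leaf (node l r)
  right : ∀ {l r} → Leaf r → Leaf (node l r)

-- LeafC t x y z  :  C(x;yz) in the leaf structure of t, i.e. the youngest
-- common ancestor of y,z is a proper descendant of the youngest common
-- ancestor of x,y,z.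
LeafC : (t : Tree) → Leaf t → Leaf t → Leaf t → Set
LeafC leaf here here here = ⊥
LeafC (node l r) (left x)  (left y)  (left z)  = LeafC l x y z
LeafC (node l r) (right x) (right y) (right z) = LeafC r x y z
LeafC (node l r) (right x) (left y)  (left z)  = ⊤
LeafC (node l r) (left x)  (right y) (right z) = ⊤
LeafC (node l r) _ _ _ = ⊥

module _ {L : Set} (C : L → L → L → Set) where

  IsAutC : (L → L) → Set
  IsAutC α = Bijective _≡_ _≡_ α
           × (∀ x y z → C x y z → C (α x) (α y) (α z))
           × (∀ x y z → C (α x) (α y) (α z) → C x y z)

  IsoToLeafStructure : ∀ {n} → (Fin n → L) → Set
  IsoToLeafStructure {n} f =
    Σ Tree λ t → Σ (Fin n → Leaf t) λ φ →
      Bijective _≡_ _≡_ φ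
      × (∀ i j k → (C (f i) (f j) (f k) → LeafC t (φ i) (φ j) (φ k))
                 × (LeafC t (φ i) (φ j) (φ k) → C (f i) (f j) (f k)))

  LeafEmbeds : Tree → Set
  LeafEmbeds t = Σ (Leaf t → L) λ e →
      Injective _≡_ _≡_ e
      × (∀ x y z → (LeafC t x y z → C (e x) (e y) (e z))
                 × (C (e x) (e y) (e z) → LeafC t x y z))

record LStructure : Set₁ where
  field
    L   : Set
    C   : L → L → L → Set
    _≺_ : L → L → Set

    countable : Σ (L → ℕ) (Injective _≡_ _≡_)

    age-⊆ : ∀ n → n ≥ 1 → (f : Fin n → L) → Injective _≡_ _≡_ f →
            IsoToLeafStructure C f
    age-⊇ : ∀ t → LeafEmbeds C t

    homogeneous : ∀ n (f g : Fin n → L) →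
      Injective _≡_ _≡_ f → Injective _≡_ _≡_ g →
      (∀ i j k → (C (f i) (f j) (f k) → C (g i) (g j) (g k))
               × (C (g i) (g j) (g k) → C (f i) (f j) (f k))) →
      Σ (L → L) λ α → IsAutC C α × (∀ i → α (f i) ≡ g i)

    ≺-irrefl : ∀ x → ¬ (x ≺ x)
    ≺-trans  : ∀ x y z → x ≺ y → y ≺ z → x ≺ z
    ≺-total  : ∀ x y → x ≢ y → (x ≺ y) ⊎ (y ≺ x)

    convex : ∀ x y z → C z x y → ¬ (x ≺ z × z ≺ y) × ¬ (y ≺ z × z ≺ x)

    homogeneous≺ : ∀ n (f g : Fin n → L) →
      Injective _≡_ _≡_ f → Injective _≡_ _≡_ g →
      (∀ i j k → (C (f i) (f j) (f k) → C (g i) (g j) (g k))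
               × (C (g i) (g j) (g k) → C (f i) (f j) (f k))) →
      (∀ i j → (f i ≺ f j → g i ≺ g j) × (g i ≺ g j → f i ≺ f j)) →
      Σ (L → L) λ α → IsAutC C α
                     × (∀ x y → (x ≺ y → α x ≺ α y) × (α x ≺ α y → x ≺ y))
                     × (∀ i → α (f i) ≡ g i)

module Notions (𝕃 : LStructure) where
  open LStructure 𝕃

  Aut : (L → L) → Set
  Aut = IsAutC C

  _∙_∣_ : L → L → L → Set
  x ∙ y ∣ z = C z x y

  _∣∣_ : (L → Set) → (L → Set) → Set
  Y ∣∣ Z = (∀ y y' z → Y y → Y y' → Z z → y ∙ y' ∣ z)
         × (∀ z z' y → Z z → Z z' → Y y → z ∙ z' ∣ y)

  image : (L → L) → (L → Set) → (L → Set)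
  image e B w = ∃ λ b → B b × e b ≡ w

  singleton : L → (L → Set)
  singleton c w = w ≡ c

  _∩_ : (L → Set) → (L → Set) → (L → Set)
  (A ∩ B) x = A x × B x

  S : L → L → (L → Set)
  S c x y = y ≢ c × x ∙ y ∣ c

  Universal : L → (L → Set) → Set
  Universal c A = ∀ n (U : Fin n → L) (i : Fin n) →
    Σ (L → L) λ α → Aut α × α (U i) ≡ c × (∀ j → A (α (U j)) ⊎ α (U j) ≡ c)

  PreservesCOn : (L → L) → (L → Set) → Set
  PreservesCOn e B = ∀ x y z → B x → B y → B z → C x y z → C (e x) (e y) (e z)

  -- e behaves as ~rer_c on A  (conditions (1)-(4); (4): x|yc  ⇒  e(y)|e(x)e(c))
  BehavesRer : L → (L → L) → (L → Set) → Set
  BehavesRer c e A =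
      (∀ a → A a → image e (singleton c) ∣∣ image e (A ∩ S c a))
    × (∀ a → A a → PreservesCOn e (A ∩ S c a))
    × (∀ a b → A a → A b →
         (∀ y → (S c a y → S c b y) × (S c b y → S c a y))
         ⊎ (image e (A ∩ S c a) ∣∣ image e (A ∩ S c b)))
    × (∀ x y → A x → A y → y ∙ c ∣ x → e x ∙ e c ∣ e y)

  data Comp (F : (L → L) → Set) : (L → L) → Set where
    gen  : ∀ {f} → F f → Comp F f
    comp : ∀ {f g} → Comp F f → Comp F g → Comp F (f ∘ g)

  Generates : ((L → L) → Set) → (L → L) → Set
  Generates F h = ∀ n (A' : Fin n → L) →
    Σ (L → L) λ f → Comp F f × (∀ i → f (A' i) ≡ h (A' i))

  Preserves≺ : (L → L) → Set
  Preserves≺ h = ∀ x y → x ≺ y → h x ≺ h y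

  BehavesLin : (L → L) → Set
  BehavesLin h = ∀ x y z → x ≺ y → y ≺ z → h y ∙ h z ∣ h x

  GAut : (L → L) → ((L → L) → Set)
  GAut g f = (∀ x → f x ≡ g x) ⊎ Aut f

module Submission where

-- On a finite set listed as x₁ ≺ ⋯ ≺ xₙ, a ≺-preserving map h with behaviour lin is a comb: each
-- h(xᵢ) splits off from the images of all later points. So, by homogeneity of (𝕃;C), it suffices to
-- generate a map F that is a comb on the same set: an automorphism then carries F(xᵢ) to h(xᵢ).
-- F is built by splitting off xₙ, …, x₁ in turn. To split a point x off a finite set W, move x to c
-- by an automorphism sending W into A (c-universality) and apply g. By conditions (1), (2) and (4)
-- of rer, this keeps the branches of W as seen from x and the C-relation inside each branch, but
-- reverses the order in which the branches hang off the path to x. Repeating the move at a new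
-- sibling of the image of x reverses that order back, and the composite preserves C on W while
-- separating the image of x from the image of W.

open import Data.Empty using (⊥; ⊥-elim)
open import Data.Fin using (Fin; zero; suc; #_)
open import Data.List using (List; []; _∷_; length; lookup; map; filter; tabulate; deduplicate)
open import Data.List.Membership.Propositional using (_∈_; _∉_)
open import Data.List.Membership.Propositional.Properties
  using (∈-lookup; ∈-map⁺; ∈-map⁻; ∈-deduplicate⁺; ∈-deduplicate⁻; ∈-filter⁺; ∈-filter⁻; ∈-tabulate⁺)
open import Data.List.Relation.Binary.Permutation.Propositional using (↭-sym; ↭⇒↭ₛ)
open import Data.List.Relation.Binary.Permutation.Propositional.Properties using (∈-resp-↭)
import Data.List.Relation.Binary.Permutation.Setoid.Properties as Permutation
open import Data.List.Relation.Unary.All as All using (All; []; _∷_)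
open import Data.List.Relation.Unary.AllPairs as AllPairs using (AllPairs; []; _∷_)
open import Data.List.Relation.Unary.Any using (index; here; there)
open import Data.List.Relation.Unary.Any.Properties using (lookup-index)
open import Data.List.Relation.Unary.Linked.Properties using (Linked⇒AllPairs)
open import Data.List.Relation.Unary.Unique.Propositional using (Unique)
open import Data.List.Relation.Unary.Unique.DecPropositional.Properties using (deduplicate-!)
import Data.List.Sort
open import Data.Nat using (s≤s; z≤n)
open import Data.Nat.Properties using (eq?)
open import Data.Product using (Σ; _×_; _,_; proj₁; proj₂)
open import Data.Sum as Sum using (_⊎_; inj₁; inj₂; [_,_]′)
open import Data.Unit using (tt)
open import Function using (_∘_; id)
open import Function.Bundles using (mk↣; _⇔_; mk⇔; Equivalence)
open import Function.Construct.Identity using (bijective)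
open import Function.Definitions using (Injective)
import Function.Properties.Equivalence as ⇔
open import Relation.Binary.Bundles using (DecTotalOrder)
import Relation.Binary.Construct.StrictToNonStrict as StrictToNonStrict
open import Relation.Binary.Definitions using (DecidableEquality; Trichotomous; tri<; tri≈; tri>)
open import Relation.Binary.PropositionalEquality
  using (_≡_; _≢_; refl; sym; trans; cong; subst; subst₂; isEquivalence; setoid)
open import Relation.Binary.Structures using (IsStrictTotalOrder)
open import Relation.Nullary using (¬_; yes; no; ¬?)

open import Defs

-- Leaf structures of binary trees

leafC-irrefl : ∀ t (x y : Leaf t) → ¬ LeafC t x x y
leafC-irrefl leaf       here      here      ()
leafC-irrefl (node l r) (left x)  (left y)  p = leafC-irrefl l x y p
leafC-irrefl (node l r) (right x) (right y) p = leafC-irrefl r x y p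

leafC-sym : ∀ t (x y z : Leaf t) → LeafC t x y z → LeafC t x z y
leafC-sym leaf       here      here      here      ()
leafC-sym (node l r) (left x)  (left y)  (left z)  p = leafC-sym l x y z p
leafC-sym (node l r) (left x)  (right y) (right z) p = tt
leafC-sym (node l r) (right x) (left y)  (left z)  p = tt
leafC-sym (node l r) (right x) (right y) (right z) p = leafC-sym r x y z p

leafC-asym : ∀ t (x y z : Leaf t) → LeafC t x y z → ¬ LeafC t y x z
leafC-asym leaf       here      here      here      ()
leafC-asym (node l r) (left x)  (left y)  (left z)  p = leafC-asym l x y z p
leafC-asym (node l r) (left x)  (right y) (right z) p ()
leafC-asym (node l r) (right x) (left y)  (left z)  p ()
leafC-asym (node l r) (right x) (right y) (right z) p = leafC-asym r x y z p

leafC-cotrans : ∀ t (x y z w : Leaf t) → LeafC t x y z → LeafC t x y w ⊎ LeafC t w y z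
leafC-cotrans leaf       here      here      here      here      ()
leafC-cotrans (node l r) (left x)  (left y)  (left z)  (left w)  p = leafC-cotrans l x y z w p
leafC-cotrans (node l r) (left x)  (left y)  (left z)  (right w) p = inj₂ tt
leafC-cotrans (node l r) (left x)  (right y) (right z) (left w)  p = inj₂ tt
leafC-cotrans (node l r) (left x)  (right y) (right z) (right w) p = inj₁ tt
leafC-cotrans (node l r) (right x) (left y)  (left z)  (left w)  p = inj₁ tt
leafC-cotrans (node l r) (right x) (left y)  (left z)  (right w) p = inj₂ tt
leafC-cotrans (node l r) (right x) (right y) (right z) (left w)  p = inj₂ tt
leafC-cotrans (node l r) (right x) (right y) (right z) (right w) p = leafC-cotrans r x y z w p

leafC-diag : ∀ t (x y : Leaf t) → x ≢ y → LeafC t x y y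
leafC-diag leaf       here      here      x≢y = x≢y refl
leafC-diag (node l r) (left x)  (left y)  x≢y = leafC-diag l x y (x≢y ∘ cong left)
leafC-diag (node l r) (left x)  (right y) x≢y = tt
leafC-diag (node l r) (right x) (left y)  x≢y = tt
leafC-diag (node l r) (right x) (right y) x≢y = leafC-diag r x y (x≢y ∘ cong right)

leafC-trichotomy : ∀ t (x y z : Leaf t) → x ≢ y → y ≢ z → x ≢ z →
                   LeafC t x y z ⊎ LeafC t y x z ⊎ LeafC t z x y
leafC-trichotomy leaf here here here x≢y _ _ = ⊥-elim (x≢y refl)
leafC-trichotomy (node l r) (left x) (left y) (left z) x≢y y≢z x≢z =
  leafC-trichotomy l x y z (x≢y ∘ cong left) (y≢z ∘ cong left) (x≢z ∘ cong left)
leafC-trichotomy (node l r) (left x)  (left y)  (right z) _ _ _ = inj₂ (inj₂ tt)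
leafC-trichotomy (node l r) (left x)  (right y) (left z)  _ _ _ = inj₂ (inj₁ tt)
leafC-trichotomy (node l r) (left x)  (right y) (right z) _ _ _ = inj₁ tt
leafC-trichotomy (node l r) (right x) (left y)  (left z)  _ _ _ = inj₁ tt
leafC-trichotomy (node l r) (right x) (left y)  (right z) _ _ _ = inj₂ (inj₁ tt)
leafC-trichotomy (node l r) (right x) (right y) (left z)  _ _ _ = inj₂ (inj₂ tt)
leafC-trichotomy (node l r) (right x) (right y) (right z) x≢y y≢z x≢z =
  leafC-trichotomy r x y z (x≢y ∘ cong right) (y≢z ∘ cong right) (x≢z ∘ cong right)

sprout : (t : Tree) → Leaf t → Tree
sprout leaf       here      = node leaf leaf
sprout (node l r) (left a)  = node (sprout l a) r
sprout (node l r) (right a) = node l (sprout r a)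

sibling : (t : Tree) (a : Leaf t) → Leaf (sprout t a)
sibling leaf       here      = right here
sibling (node l r) (left a)  = left (sibling l a)
sibling (node l r) (right a) = right (sibling r a)

inherited : (t : Tree) (a : Leaf t) → Leaf t → Leaf (sprout t a)
inherited leaf       here      here      = left here
inherited (node l r) (left a)  (left b)  = left (inherited l a b)
inherited (node l r) (left a)  (right b) = right b
inherited (node l r) (right a) (left b)  = left b
inherited (node l r) (right a) (right b) = right (inherited r a b)

left-injective : ∀ {l r} {u v : Leaf l} → left {r = r} u ≡ left v → u ≡ v
left-injective refl = refl

right-injective : ∀ {l r} {u v : Leaf r} → right {l = l} u ≡ right v → u ≡ v
right-injective refl = refl

inherited-injective : ∀ t a (b b′ : Leaf t) → inherited t a b ≡ inherited t a b′ → b ≡ b′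
inherited-injective leaf       here      here      here      _  = refl
inherited-injective (node l r) (left a)  (left b)  (left b′)  eq = cong left (inherited-injective l a b b′ (left-injective eq))
inherited-injective (node l r) (left a)  (right b) (right b′) eq = cong right (right-injective eq)
inherited-injective (node l r) (right a) (left b)  (left b′)  eq = cong left (left-injective eq)
inherited-injective (node l r) (right a) (right b) (right b′) eq = cong right (inherited-injective r a b b′ (right-injective eq))

inherited≢sibling : ∀ t a (b : Leaf t) → inherited t a b ≢ sibling t a
inherited≢sibling leaf       here      here      ()
inherited≢sibling (node l r) (left a)  (left b)  eq = inherited≢sibling l a b (left-injective eq)
inherited≢sibling (node l r) (right a) (right b) eq = inherited≢sibling r a b (right-injective eq)

leafC-inherited : ∀ t a (x y z : Leaf t) →
                  LeafC (sprout t a) (inherited t a x) (inherited t a y) (inherited t a z) ≡ LeafC t x y z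
leafC-inherited leaf here here here here = refl
leafC-inherited (node l r) (left a) (left x) (left y) (left z) = leafC-inherited l a x y z
leafC-inherited (node l r) (right a) (right x) (right y) (right z) = leafC-inherited r a x y z
leafC-inherited (node l r) (left a)  (left x)  (left y)  (right z) = refl
leafC-inherited (node l r) (left a)  (left x)  (right y) (left z)  = refl
leafC-inherited (node l r) (left a)  (left x)  (right y) (right z) = refl
leafC-inherited (node l r) (left a)  (right x) (left y)  (left z)  = refl
leafC-inherited (node l r) (left a)  (right x) (left y)  (right z) = refl
leafC-inherited (node l r) (left a)  (right x) (right y) (left z)  = refl
leafC-inherited (node l r) (left a)  (right x) (right y) (right z) = refl
leafC-inherited (node l r) (right a) (left x)  (left y)  (left z)  = refl
leafC-inherited (node l r) (right a) (left x)  (left y)  (right z) = refl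
leafC-inherited (node l r) (right a) (left x)  (right y) (left z)  = refl
leafC-inherited (node l r) (right a) (left x)  (right y) (right z) = refl
leafC-inherited (node l r) (right a) (right x) (left y)  (left z)  = refl
leafC-inherited (node l r) (right a) (right x) (left y)  (right z) = refl
leafC-inherited (node l r) (right a) (right x) (right y) (left z)  = refl

leafC-sibling : ∀ t a (b : Leaf t) → b ≢ a → LeafC (sprout t a) (inherited t a b) (inherited t a a) (sibling t a)
leafC-sibling leaf       here      here      b≢a = b≢a refl
leafC-sibling (node l r) (left a)  (left b)  b≢a = leafC-sibling l a b (b≢a ∘ cong left)
leafC-sibling (node l r) (left a)  (right b) _   = tt
leafC-sibling (node l r) (right a) (left b)  _   = tt
leafC-sibling (node l r) (right a) (right b) b≢a = leafC-sibling r a b (b≢a ∘ cong right)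

lookup-injective : ∀ {a} {X : Set a} {xs : List X} → Unique xs →
                   ∀ {i j} → lookup xs i ≡ lookup xs j → i ≡ j
lookup-injective (_  ∷ _) {zero}  {zero}  _  = refl
lookup-injective (x∉ ∷ _) {zero}  {suc j} eq = ⊥-elim (All.lookup x∉ (∈-lookup j) eq)
lookup-injective (x∉ ∷ _) {suc i} {zero}  eq = ⊥-elim (All.lookup x∉ (∈-lookup i) (sym eq))
lookup-injective (_  ∷ u) {suc i} {suc j} eq = cong suc (lookup-injective u eq)

module Properties (𝕃 : LStructure) where
  open LStructure 𝕃
  open Notions 𝕃

  -- The axioms of a C-relation, read off finite leaf structures

  _≟_ : DecidableEquality L
  _≟_ = eq? (mk↣ (proj₂ countable))

  record LeafModel (xs : List L) : Set where
    field
      tree             : Tree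
      leafAt           : Fin (length xs) → Leaf tree
      leafAt-injective : Injective _≡_ _≡_ leafAt
      C⇒leafC          : ∀ i j k → C (lookup xs i) (lookup xs j) (lookup xs k) →
                         LeafC tree (leafAt i) (leafAt j) (leafAt k)
      leafC⇒C          : ∀ i j k → LeafC tree (leafAt i) (leafAt j) (leafAt k) →
                         C (lookup xs i) (lookup xs j) (lookup xs k)

    leafAt-distinct : ∀ {i j} → i ≢ j → leafAt i ≢ leafAt j
    leafAt-distinct i≢j = i≢j ∘ leafAt-injective

  leafModel : ∀ x xs → Unique (x ∷ xs) → LeafModel (x ∷ xs)
  leafModel x xs unique with age-⊆ _ (s≤s z≤n) (lookup (x ∷ xs)) (lookup-injective unique)
  ... | t , φ , (φ-injective , _) , iso = record
    { tree = t ; leafAt = φ ; leafAt-injective = φ-injective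
    ; C⇒leafC = λ i j k → proj₁ (iso i j k) ; leafC⇒C = λ i j k → proj₂ (iso i j k) }

  C-irrefl : ∀ {x z} → ¬ C x x z
  C-irrefl {x} {z} c with x ≟ z
  ... | yes refl = let open LeafModel (leafModel x [] ([] ∷ [])) in
    leafC-irrefl tree _ _ (C⇒leafC (# 0) (# 0) (# 0) c)
  ... | no x≢z = let open LeafModel (leafModel x (z ∷ []) ((x≢z ∷ []) ∷ [] ∷ [])) in
    leafC-irrefl tree _ _ (C⇒leafC (# 0) (# 0) (# 1) c)

  C⇒≢₁ : ∀ {x y z} → C x y z → x ≢ y
  C⇒≢₁ c refl = C-irrefl c

  C⇒≢₂ : ∀ {x y z} → C x y z → x ≢ z
  C⇒≢₂ {x} {y} c refl with x ≟ y
  ... | yes refl = C-irrefl c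
  ... | no x≢y = let open LeafModel (leafModel x (y ∷ []) ((x≢y ∷ []) ∷ [] ∷ [])) in
    leafC-irrefl tree _ _ (leafC-sym tree _ _ _ (C⇒leafC (# 0) (# 1) (# 0) c))

  C-diag : ∀ {x y} → x ≢ y → C x y y
  C-diag {x} {y} x≢y = let open LeafModel (leafModel x (y ∷ []) ((x≢y ∷ []) ∷ [] ∷ [])) in
    leafC⇒C (# 0) (# 1) (# 1) (leafC-diag tree _ _ (leafAt-distinct λ ()))

  C-sym : ∀ {x y z} → C x y z → C x z y
  C-sym {x} {y} {z} c with y ≟ z
  ... | yes refl = c
  ... | no y≢z = let open LeafModel (leafModel x (y ∷ z ∷ []) ((C⇒≢₁ c ∷ C⇒≢₂ c ∷ []) ∷ (y≢z ∷ []) ∷ [] ∷ [])) in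
    leafC⇒C (# 0) (# 2) (# 1) (leafC-sym tree _ _ _ (C⇒leafC (# 0) (# 1) (# 2) c))

  C-asym : ∀ {x y z} → C x y z → ¬ C y x z
  C-asym {x} {y} {z} c c′ with y ≟ z
  ... | yes refl = C⇒≢₂ c′ refl
  ... | no y≢z = let open LeafModel (leafModel x (y ∷ z ∷ []) ((C⇒≢₁ c ∷ C⇒≢₂ c ∷ []) ∷ (y≢z ∷ []) ∷ [] ∷ [])) in
    leafC-asym tree _ _ _ (C⇒leafC (# 0) (# 1) (# 2) c) (C⇒leafC (# 1) (# 0) (# 2) c′)

  C-trichotomy : ∀ {x y z} → x ≢ y → y ≢ z → x ≢ z → C x y z ⊎ C y x z ⊎ C z x y
  C-trichotomy {x} {y} {z} x≢y y≢z x≢z =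
    Sum.map (leafC⇒C (# 0) (# 1) (# 2)) (Sum.map (leafC⇒C (# 1) (# 0) (# 2)) (leafC⇒C (# 2) (# 0) (# 1)))
      (leafC-trichotomy tree _ _ _ (leafAt-distinct λ ()) (leafAt-distinct λ ()) (leafAt-distinct λ ()))
    where open LeafModel (leafModel x (y ∷ z ∷ []) ((x≢y ∷ x≢z ∷ []) ∷ (y≢z ∷ []) ∷ [] ∷ []))

  C-cotrans : ∀ {x y z} w → C x y z → C x y w ⊎ C w y z
  C-cotrans {x} {y} {z} w c with y ≟ z | w ≟ y
  ... | yes refl | yes refl = inj₁ c
  ... | yes refl | no w≢y   = inj₂ (C-diag w≢y)
  ... | no _     | yes refl = inj₁ (C-diag (C⇒≢₁ c))
  ... | no y≢z   | no w≢y   with w ≟ x | w ≟ z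
  ...   | yes refl | _        = inj₂ c
  ...   | no _     | yes refl = inj₁ c
  ...   | no w≢x   | no w≢z   =
    Sum.map (leafC⇒C (# 0) (# 1) (# 3)) (leafC⇒C (# 3) (# 1) (# 2))
      (leafC-cotrans tree _ _ _ _ (C⇒leafC (# 0) (# 1) (# 2) c))
    where open LeafModel (leafModel x (y ∷ z ∷ w ∷ [])
            ( (C⇒≢₁ c ∷ C⇒≢₂ c ∷ (w≢x ∘ sym) ∷ [])
            ∷ (y≢z ∷ (w≢y ∘ sym) ∷ []) ∷ ((w≢z ∘ sym) ∷ []) ∷ [] ∷ []))

  ∙∣-trans : ∀ {x y z a} → x ∙ y ∣ a → y ∙ z ∣ a → x ∙ z ∣ a
  ∙∣-trans {x} {z = z} xy∣a yz∣a with C-cotrans z xy∣a | C-cotrans x (C-sym yz∣a)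
  ... | inj₁ xz∣a | _         = xz∣a
  ... | inj₂ _    | inj₁ zx∣a = C-sym zx∣a
  ... | inj₂ xy∣z | inj₂ zy∣x = ⊥-elim (C-asym xy∣z zy∣x)

  ∙∣-nest : ∀ {a b c d} → a ∙ b ∣ c → a ∙ d ∣ b → b ∙ d ∣ c × a ∙ d ∣ c
  ∙∣-nest {d = d} ab∣c ad∣b with C-cotrans d ab∣c
  ... | inj₁ ad∣c = ∙∣-trans (C-sym ab∣c) ad∣c , ad∣c
  ... | inj₂ ab∣d = ⊥-elim (C-asym (C-sym ab∣d) (C-sym ad∣b))

  ∙∣-cherries : ∀ {a b c d} → a ∙ b ∣ c → c ∙ d ∣ b → a ∙ b ∣ d × c ∙ d ∣ a
  ∙∣-cherries {a} {d = d} ab∣c cd∣b with C-cotrans a cd∣b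
  ... | inj₁ ca∣b = ⊥-elim (C-asym (C-sym ab∣c) ca∣b)
  ... | inj₂ cd∣a with C-cotrans d ab∣c
  ...   | inj₁ ad∣c = ⊥-elim (C-asym cd∣a ad∣c)
  ...   | inj₂ ab∣d = ab∣d , cd∣a

  SamePattern : ∀ {n} → (Fin n → L) → (Fin n → L) → Set
  SamePattern f f′ = ∀ i j k → (C (f i) (f j) (f k) → C (f′ i) (f′ j) (f′ k))
                             × (C (f′ i) (f′ j) (f′ k) → C (f i) (f j) (f k))

  record SiblingCopy (xs : List L) (a : Fin (length xs)) : Set where
    field
      copy           : Fin (length xs) → L
      copy-injective : Injective _≡_ _≡_ copy
      copy≅xs        : SamePattern copy (lookup xs)
      new            : L
      new-fresh      : ∀ i → new ≢ copy i
      new-sibling    : ∀ i → i ≢ a → copy a ∙ new ∣ copy i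

  siblingCopy : ∀ {x xs} → Unique (x ∷ xs) → ∀ a → SiblingCopy (x ∷ xs) a
  siblingCopy {x} {xs} unique a = fromEmbedding (age-⊇ t′)
    where
    open LeafModel (leafModel x xs unique)

    t′ : Tree
    t′ = sprout tree (leafAt a)

    ι : Fin (length (x ∷ xs)) → Leaf t′
    ι = inherited tree (leafAt a) ∘ leafAt

    fromEmbedding : LeafEmbeds C t′ → SiblingCopy (x ∷ xs) a
    fromEmbedding (e , e-injective , e-iso) = record
      { copy           = e ∘ ι
      ; copy-injective = leafAt-injective ∘ inherited-injective tree (leafAt a) _ _ ∘ e-injective
      ; copy≅xs        = λ i j k →
          (λ c → leafC⇒C i j k (subst id (leafC-inherited tree (leafAt a) _ _ _) (proj₂ (e-iso _ _ _) c)))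
        , (λ c → proj₁ (e-iso _ _ _) (subst id (sym (leafC-inherited tree (leafAt a) _ _ _)) (C⇒leafC i j k c)))
      ; new            = e (sibling tree (leafAt a))
      ; new-fresh      = λ i → inherited≢sibling tree (leafAt a) (leafAt i) ∘ sym ∘ e-injective
      ; new-sibling    = λ i i≢a → proj₁ (e-iso _ _ _) (leafC-sibling tree (leafAt a) _ (leafAt-distinct i≢a))
      }

  Sibling : L → L → List L → Set
  Sibling x p V = ∀ {v} → v ∈ V → x ∙ p ∣ v

  sibling-exists : ∀ x V → x ∉ V → Σ L λ p → p ≢ x × Sibling x p V
  sibling-exists x V x∉V =
    fromAutomorphism (homogeneous _ copy (lookup xs) copy-injective (lookup-injective xs-unique) copy≅xs)
    where
    xs : List L
    xs = x ∷ deduplicate _≟_ V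

    xs-unique : Unique xs
    xs-unique = All.tabulate (λ v∈ x≡v → x∉V (subst (_∈ V) (sym x≡v) (∈-deduplicate⁻ _≟_ V v∈)))
              ∷ deduplicate-! _≟_ V

    open SiblingCopy (siblingCopy xs-unique (# 0))

    fromAutomorphism : Σ (L → L) (λ β → Aut β × (∀ i → β (copy i) ≡ lookup xs i)) →
                       Σ L λ p → p ≢ x × Sibling x p V
    fromAutomorphism (β , ((β-injective , _) , β-preservesC , _) , β∘copy≡xs) =
      β new , β-new≢x , β-new-sibling
      where
      β-new≢x : β new ≢ x
      β-new≢x β-new≡x = new-fresh (# 0) (β-injective (trans β-new≡x (sym (β∘copy≡xs (# 0)))))

      β-new-sibling : Sibling x (β new) V
      β-new-sibling {v} v∈V =
        subst (λ v → x ∙ β new ∣ v) (sym (lookup-index v∈))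
          (subst₂ (λ u a → a ∙ β new ∣ u) (β∘copy≡xs (suc (index v∈))) (β∘copy≡xs (# 0))
            (β-preservesC _ _ _ (new-sibling (suc (index v∈)) λ ())))
        where
        v∈ : v ∈ deduplicate _≟_ V
        v∈ = ∈-deduplicate⁺ _≟_ v∈V

  sibling-∉ : ∀ {x p V} → p ≢ x → Sibling x p V → p ∉ x ∷ V
  sibling-∉ p≢x _         (here p≡x) = p≢x p≡x
  sibling-∉ _   p-sibling (there p∈) = C⇒≢₂ (p-sibling p∈) refl

  record PivotMap (x x′ : L) (W : List L) (F : L → L) : Set where
    field
      branches : ∀ {y z} → y ∈ W → z ∈ W → y ∙ z ∣ x → F y ∙ F z ∣ x′
      within   : ∀ {y z w} → y ∈ W → z ∈ W → w ∈ W →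
                 y ∙ z ∣ x → y ∙ w ∣ x → z ∙ w ∣ y → F z ∙ F w ∣ F y

  -- z ∙ x ∣ y: seen from x, the branch of y joins the path to the root above the branch of z.
  KeepsDepth ReversesDepth : L → L → List L → (L → L) → Set
  KeepsDepth    x x′ W F = ∀ {y z} → y ∈ W → z ∈ W → z ∙ x ∣ y → F z ∙ x′ ∣ F y
  ReversesDepth x x′ W F = ∀ {y z} → y ∈ W → z ∈ W → z ∙ x ∣ y → F y ∙ x′ ∣ F z

  pivot-∉ : ∀ {x x′ W F} → PivotMap x x′ W F → x ∉ W → x′ ∉ map F W
  pivot-∉ φ x∉W x′∈FW with ∈-map⁻ _ x′∈FW
  ... | y , y∈W , x′≡Fy =
    C⇒≢₁ (PivotMap.branches φ y∈W y∈W (C-diag λ { refl → x∉W y∈W })) x′≡Fy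

  pivot-retarget : ∀ {x x′ p W F} → PivotMap x x′ W F → ReversesDepth x x′ W F →
                   Sibling x′ p (map F W) → PivotMap x p W F × ReversesDepth x p W F
  pivot-retarget {x′ = x′} {p} {W} {F} φ reverses sibling′ =
    record { branches = λ y∈ z∈ → proj₂ ∘ ∙∣-cherries (C-sym (p-sibling y∈)) ∘ branches y∈ z∈
           ; within   = within }
    , λ y∈ z∈ zx∣y → proj₁ (∙∣-nest (C-sym (reverses y∈ z∈ zx∣y)) (p-sibling y∈))
    where
    open PivotMap φ
    p-sibling : ∀ {y} → y ∈ W → x′ ∙ p ∣ F y
    p-sibling = sibling′ ∘ ∈-map⁺ F

  pivot-compose : ∀ {x x′ x″ W V F G} →
                  PivotMap x x′ W F → ReversesDepth x x′ W F → (∀ {y} → y ∈ W → F y ∈ V) →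
                  PivotMap x′ x″ V G → ReversesDepth x′ x″ V G →
                  PivotMap x x″ W (G ∘ F) × KeepsDepth x x″ W (G ∘ F)
  pivot-compose φ F-reverses F∈V ψ G-reverses =
    record { branches = λ y∈ z∈ → G.branches (F∈V y∈) (F∈V z∈) ∘ F.branches y∈ z∈
           ; within   = λ y∈ z∈ w∈ yz∣x yw∣x zw∣y →
               G.within (F∈V y∈) (F∈V z∈) (F∈V w∈) (F.branches y∈ z∈ yz∣x) (F.branches y∈ w∈ yw∣x)
                        (F.within y∈ z∈ w∈ yz∣x yw∣x zw∣y) }
    , λ y∈ z∈ → G-reverses (F∈V z∈) (F∈V y∈) ∘ F-reverses y∈ z∈
    where
    module F = PivotMap φ
    module G = PivotMap ψ

  -- The C-relation on W ∪ {x} is determined by the branches of W at x, by C inside each branch,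
  -- and by the depth order of the branches; a pivot map keeping all three preserves C on W.
  module _ {x x′ W F} (x∉W : x ∉ W) (φ : PivotMap x x′ W F) (keeps : KeepsDepth x x′ W F) where
    open PivotMap φ

    private
      x≢ : ∀ {y} → y ∈ W → x ≢ y
      x≢ y∈W refl = x∉W y∈W

      sameBranch : ∀ {y z w} → y ∈ W → z ∈ W → w ∈ W → z ∙ w ∣ x → z ∙ w ∣ y → F z ∙ F w ∣ F y
      sameBranch y∈ z∈ w∈ zw∣x zw∣y with C-trichotomy (x≢ y∈) (C⇒≢₁ zw∣y) (x≢ z∈)
      ... | inj₁ yz∣x        = within y∈ z∈ w∈ yz∣x (∙∣-trans yz∣x zw∣x) zw∣y
      ... | inj₂ (inj₁ xz∣y) = proj₂ (∙∣-nest (keeps y∈ z∈ (C-sym xz∣y)) (branches z∈ w∈ zw∣x))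
      ... | inj₂ (inj₂ xy∣z) = proj₂ (∙∣-cherries (keeps z∈ y∈ (C-sym xy∣z)) (branches z∈ w∈ zw∣x))

    pivot-preservesC : PreservesCOn F (_∈ W)
    pivot-preservesC y z w y∈ z∈ w∈ zw∣y with C-cotrans x zw∣y | C-cotrans x (C-sym zw∣y)
    ... | inj₂ zw∣x | _         = sameBranch y∈ z∈ w∈ zw∣x zw∣y
    ... | inj₁ _    | inj₂ wz∣x = sameBranch y∈ z∈ w∈ (C-sym wz∣x) zw∣y
    ... | inj₁ zx∣y | inj₁ wx∣y = ∙∣-trans (keeps y∈ z∈ zx∣y) (C-sym (keeps y∈ w∈ wx∣y))

  SplitsOff : L → List L → (L → L) → Set
  SplitsOff x W G = (∀ {y z} → y ∈ W → z ∈ W → G y ∙ G z ∣ G x) × PreservesCOn G (_∈ W)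

  twoReversals-splitOff : ∀ {x p W e₁ e₂} → x ∉ W →
    PivotMap x (e₁ x) W e₁ → ReversesDepth x (e₁ x) W e₁ → Sibling (e₁ x) p (map e₁ W) →
    PivotMap p (e₂ p) (e₁ x ∷ map e₁ W) e₂ → ReversesDepth p (e₂ p) (e₁ x ∷ map e₁ W) e₂ →
    SplitsOff x W (e₂ ∘ e₁)
  twoReversals-splitOff {x} {p} {W} {e₁} {e₂} x∉W φ₁ reverses₁ p-sibling φ₂ reverses₂ =
    separated , pivot-preservesC x∉W (proj₁ composite) (proj₂ composite)
    where
    retargeted : PivotMap x p W e₁ × ReversesDepth x p W e₁
    retargeted = pivot-retarget φ₁ reverses₁ p-sibling

    composite : PivotMap x (e₂ p) W (e₂ ∘ e₁) × KeepsDepth x (e₂ p) W (e₂ ∘ e₁)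
    composite = pivot-compose (proj₁ retargeted) (proj₂ retargeted) (there ∘ ∈-map⁺ e₁) φ₂ reverses₂

    toward-e₂p : ∀ {y} → y ∈ W → e₂ (e₁ y) ∙ e₂ p ∣ e₂ (e₁ x)
    toward-e₂p y∈ = reverses₂ (there (∈-map⁺ e₁ y∈)) (here refl) (p-sibling (∈-map⁺ e₁ y∈))

    separated : ∀ {y z} → y ∈ W → z ∈ W → e₂ (e₁ y) ∙ e₂ (e₁ z) ∣ e₂ (e₁ x)
    separated y∈ z∈ = ∙∣-trans (toward-e₂p y∈) (C-sym (toward-e₂p z∈))

  ≺⇒≢ : ∀ {x y} → x ≺ y → x ≢ y
  ≺⇒≢ x≺x refl = ≺-irrefl _ x≺x

  ≺-asym : ∀ {x y} → x ≺ y → ¬ y ≺ x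
  ≺-asym x≺y y≺x = ≺-irrefl _ (≺-trans _ _ _ x≺y y≺x)

  ≺-compare : Trichotomous _≡_ _≺_
  ≺-compare x y with x ≟ y
  ... | yes refl = tri≈ (≺-irrefl x) refl (≺-irrefl x)
  ... | no x≢y with ≺-total x y x≢y
  ...   | inj₁ x≺y = tri< x≺y x≢y (≺-asym x≺y)
  ...   | inj₂ y≺x = tri> (≺-asym y≺x) x≢y y≺x

  ≺-isStrictTotalOrder : IsStrictTotalOrder _≡_ _≺_
  ≺-isStrictTotalOrder = record
    { isStrictPartialOrder = record
      { isEquivalence = isEquivalence
      ; irrefl        = λ { refl → ≺-irrefl _ }
      ; trans         = ≺-trans _ _ _
      ; <-resp-≈      = (λ { refl x≺y → x≺y }) , (λ { refl x≺y → x≺y })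
      }
    ; compare = ≺-compare
    }

  ⪯-decTotalOrder : DecTotalOrder _ _ _
  ⪯-decTotalOrder = record
    { isDecTotalOrder = StrictToNonStrict.isDecTotalOrder _≡_ _≺_ ≺-isStrictTotalOrder }

  open Data.List.Sort ⪯-decTotalOrder using (sort; sort-↗; sort-↭)

  sortedNub : List L → List L
  sortedNub xs = sort (deduplicate _≟_ xs)

  ∈-sortedNub : ∀ {x xs} → x ∈ xs → x ∈ sortedNub xs
  ∈-sortedNub = ∈-resp-↭ (↭-sym (sort-↭ _)) ∘ ∈-deduplicate⁺ _≟_

  sortedNub-strict : ∀ xs → AllPairs _≺_ (sortedNub xs)
  sortedNub-strict xs = AllPairs.zipWith ⪯∧≢⇒≺
    ( Linked⇒AllPairs (DecTotalOrder.trans ⪯-decTotalOrder) (sort-↗ _)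
    , Permutation.Unique-resp-↭ (setoid L) (↭⇒↭ₛ (↭-sym (sort-↭ _))) (deduplicate-! _≟_ xs) )
    where
    ⪯∧≢⇒≺ : ∀ {x y} → (x ≺ y ⊎ x ≡ y) × x ≢ y → x ≺ y
    ⪯∧≢⇒≺ (inj₁ x≺y , _)   = x≺y
    ⪯∧≢⇒≺ (inj₂ x≡y , x≢y) = ⊥-elim (x≢y x≡y)

  -- Combs

  InjectiveOn : List L → (L → L) → Set
  InjectiveOn W F = ∀ {u v} → u ∈ W → v ∈ W → u ≢ v → F u ≢ F v

  preservesC⇒injectiveOn : ∀ {W F} → PreservesCOn F (_∈ W) → InjectiveOn W F
  preservesC⇒injectiveOn preserves u∈ v∈ u≢v = C⇒≢₁ (preserves _ _ _ u∈ v∈ v∈ (C-diag u≢v))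

  remove : L → List L → List L
  remove v = filter (λ u → ¬? (u ≟ v))

  ∈-remove⁺ : ∀ {u v P} → u ∈ P → u ≢ v → u ∈ remove v P
  ∈-remove⁺ {v = v} = ∈-filter⁺ (λ u → ¬? (u ≟ v))

  injectiveOn⇒∉-remove : ∀ {v P F} → InjectiveOn P F → v ∈ P → F v ∉ map F (remove v P)
  injectiveOn⇒∉-remove {v} {P} {F} F-injective v∈P Fv∈ with ∈-map⁻ F Fv∈
  ... | u , u∈ , Fv≡Fu with ∈-filter⁻ (λ u → ¬? (u ≟ v)) {xs = P} u∈
  ...   | u∈P , u≢v = F-injective v∈P u∈P (u≢v ∘ sym) Fv≡Fu

  Comb : List L → (L → L) → Set
  Comb vs F = ∀ {y z w} → y ∈ vs → z ∈ vs → w ∈ vs → y ≺ z → y ≺ w → F z ∙ F w ∣ F y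

  comb⇒injectiveOn : ∀ {vs F} → Comb vs F → InjectiveOn vs F
  comb⇒injectiveOn comb {u} {v} u∈ v∈ u≢v with ≺-total u v u≢v
  ... | inj₁ u≺v = C⇒≢₁ (comb u∈ v∈ v∈ u≺v u≺v)
  ... | inj₂ v≺u = C⇒≢₁ (comb v∈ u∈ u∈ v≺u v≺u) ∘ sym

  lin⇒comb : ∀ {vs h} → Preserves≺ h → BehavesLin h → Comb vs h
  lin⇒comb mono lin {y} {z} {w} _ _ _ y≺z y≺w with z ≟ w
  ... | yes refl = C-diag (≺⇒≢ (mono _ _ y≺z))
  ... | no z≢w with ≺-total z w z≢w
  ...   | inj₁ z≺w = lin _ _ _ y≺z z≺w
  ...   | inj₂ w≺z = C-sym (lin _ _ _ y≺w w≺z)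

  comb-extend : ∀ {P v vs F G} → All (v ≺_) vs → (∀ {u} → u ∈ vs → u ∈ P) →
                InjectiveOn P F → Comb vs F → SplitsOff (F v) (map F (remove v P)) G →
                InjectiveOn P (G ∘ F) × Comb (v ∷ vs) (G ∘ F)
  comb-extend {P} {v} {vs} {F} {G} v≺vs vs⊆P F-injective F-comb (separated , G-preservesC) =
    GF-injective , GF-comb
    where
    F-other : ∀ {u} → u ∈ P → u ≢ v → F u ∈ map F (remove v P)
    F-other u∈P u≢v = ∈-map⁺ F (∈-remove⁺ u∈P u≢v)

    F-later : ∀ {u} → u ∈ vs → F u ∈ map F (remove v P)
    F-later u∈ = F-other (vs⊆P u∈) (≺⇒≢ (All.lookup v≺vs u∈) ∘ sym)

    later : ∀ {u} → u ∈ v ∷ vs → v ≺ u → u ∈ vs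
    later (here refl) v≺v = ⊥-elim (≺-irrefl _ v≺v)
    later (there u∈)  _   = u∈

    GF-injective : InjectiveOn P (G ∘ F)
    GF-injective {u} {w} u∈ w∈ u≢w with u ≟ v | w ≟ v
    ... | yes refl | yes refl = ⊥-elim (u≢w refl)
    ... | yes refl | no w≢v   = C⇒≢₁ (separated (F-other w∈ w≢v) (F-other w∈ w≢v))
    ... | no u≢v   | yes refl = C⇒≢₁ (separated (F-other u∈ u≢v) (F-other u∈ u≢v)) ∘ sym
    ... | no u≢v   | no w≢v   =
      preservesC⇒injectiveOn G-preservesC (F-other u∈ u≢v) (F-other w∈ w≢v) (F-injective u∈ w∈ u≢w)

    GF-comb : Comb (v ∷ vs) (G ∘ F)
    GF-comb (here refl) z∈ w∈ v≺z v≺w = separated (F-later (later z∈ v≺z)) (F-later (later w∈ v≺w))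
    GF-comb {y} (there y∈) z∈ w∈ y≺z y≺w =
      G-preservesC _ _ _ (F-later y∈) (F-later (later′ z∈ y≺z)) (F-later (later′ w∈ y≺w))
        (F-comb y∈ (later′ z∈ y≺z) (later′ w∈ y≺w) y≺z y≺w)
      where
      later′ : ∀ {u} → u ∈ v ∷ vs → y ≺ u → u ∈ vs
      later′ u∈ y≺u = later u∈ (≺-trans _ _ _ (All.lookup v≺vs y∈) y≺u)

  CombPattern : L → L → L → Set
  CombPattern y z w = (y ≺ z × y ≺ w) ⊎ (y ≢ z × z ≡ w)

  comb-pattern : ∀ {vs F y z w} → Comb vs F → y ∈ vs → z ∈ vs → w ∈ vs →
                 F z ∙ F w ∣ F y ⇔ CombPattern y z w
  comb-pattern {F = F} {y} {z} {w} comb y∈ z∈ w∈ = mk⇔ to from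
    where
    from : CombPattern y z w → F z ∙ F w ∣ F y
    from (inj₁ (y≺z , y≺w))  = comb y∈ z∈ w∈ y≺z y≺w
    from (inj₂ (y≢z , refl)) = C-diag (comb⇒injectiveOn comb y∈ z∈ y≢z)

    zLeast : F z ∙ F w ∣ F y → z ≺ y → z ≺ w → ⊥
    zLeast zw∣y z≺y z≺w = C-asym zw∣y (comb z∈ y∈ w∈ z≺y z≺w)

    wLeast : F z ∙ F w ∣ F y → w ≺ y → w ≺ z → ⊥
    wLeast zw∣y w≺y w≺z = C-asym (C-sym zw∣y) (comb w∈ y∈ z∈ w≺y w≺z)

    to : F z ∙ F w ∣ F y → CombPattern y z w
    to zw∣y with z ≟ w | ≺-total y z (C⇒≢₁ zw∣y ∘ cong F) | ≺-total y w (C⇒≢₂ zw∣y ∘ cong F)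
    ... | yes refl | _        | _        = inj₂ (C⇒≢₁ zw∣y ∘ cong F , refl)
    ... | no _     | inj₁ y≺z | inj₁ y≺w = inj₁ (y≺z , y≺w)
    ... | no _     | inj₁ y≺z | inj₂ w≺y = ⊥-elim (wLeast zw∣y w≺y (≺-trans _ _ _ w≺y y≺z))
    ... | no _     | inj₂ z≺y | inj₁ y≺w = ⊥-elim (zLeast zw∣y z≺y (≺-trans _ _ _ z≺y y≺w))
    ... | no z≢w   | inj₂ z≺y | inj₂ w≺y = ⊥-elim ([ zLeast zw∣y z≺y , wLeast zw∣y w≺y ]′ (≺-total z w z≢w))

  injectiveOn∘lookup : ∀ {vs K} → Unique vs → InjectiveOn vs K → Injective _≡_ _≡_ (K ∘ lookup vs)
  injectiveOn∘lookup {vs} vs-unique K-injective {i} {j} eq with lookup vs i ≟ lookup vs j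
  ... | yes equal  = lookup-injective vs-unique equal
  ... | no unequal = ⊥-elim (K-injective (∈-lookup i) (∈-lookup j) unequal eq)

  homogeneous-on : ∀ {vs F H} → Unique vs → InjectiveOn vs F → InjectiveOn vs H →
                   (∀ {y z w} → y ∈ vs → z ∈ vs → w ∈ vs → (F z ∙ F w ∣ F y ⇔ H z ∙ H w ∣ H y)) →
                   Σ (L → L) λ β → Aut β × (∀ {v} → v ∈ vs → β (F v) ≡ H v)
  homogeneous-on {vs} {F} {H} vs-unique F-injective H-injective same
    with homogeneous (length vs) (F ∘ lookup vs) (H ∘ lookup vs)
           (injectiveOn∘lookup vs-unique F-injective) (injectiveOn∘lookup vs-unique H-injective)
           (λ i j k → let iff = same (∈-lookup i) (∈-lookup j) (∈-lookup k) in Equivalence.to iff , Equivalence.from iff)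
  ... | β , β-aut , β∘F≡H =
    β , β-aut , λ v∈ → subst (λ v → β (F v) ≡ H v) (sym (lookup-index v∈)) (β∘F≡H (index v∈))

module RerGenerators
  (𝕃 : LStructure) (c : LStructure.L 𝕃) (A : LStructure.L 𝕃 → Set)
  (A∌c : ∀ a → A a → a ≢ c) (universal : Notions.Universal 𝕃 c A)
  (g : LStructure.L 𝕃 → LStructure.L 𝕃) (rer : Notions.BehavesRer 𝕃 c g A)
  where
  open LStructure 𝕃
  open Notions 𝕃
  open Properties 𝕃

  Generated : (L → L) → Set
  Generated = Comp (GAut g)

  id-generated : Generated id
  id-generated = gen (inj₂ (bijective _≡_ , (λ _ _ _ → id) , (λ _ _ _ → id)))

  rer₁ : ∀ a → A a → image g (singleton c) ∣∣ image g (A ∩ S c a)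
  rer₁ = proj₁ rer

  rer₂ : ∀ a → A a → PreservesCOn g (A ∩ S c a)
  rer₂ = proj₁ (proj₂ rer)

  rer₄ : ∀ x y → A x → A y → y ∙ c ∣ x → g x ∙ g c ∣ g y
  rer₄ = proj₂ (proj₂ (proj₂ rer))

  rer-pivot : ∀ r W → r ∉ W →
              Σ (L → L) λ e → Generated e × PivotMap r (e r) W e × ReversesDepth r (e r) W e
  rer-pivot r W r∉W with universal (length (r ∷ W)) (lookup (r ∷ W)) zero
  ... | α , α-aut , αr≡c , α-into-A-or-c =
    g ∘ α , comp (gen (inj₁ λ _ → refl)) (gen (inj₂ α-aut)) ,
    record { branches = branches ; within = within } , reverses
    where
    α-injective : Injective _≡_ _≡_ α
    α-injective = proj₁ (proj₁ α-aut)

    α-preservesC : ∀ x y z → C x y z → C (α x) (α y) (α z)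
    α-preservesC = proj₁ (proj₂ α-aut)

    α-into-A : ∀ {y} → y ∈ W → A (α y)
    α-into-A {y} y∈ with α-into-A-or-c (suc (index y∈))
    ... | inj₁ in-A = subst (A ∘ α) (sym (lookup-index y∈)) in-A
    ... | inj₂ αy≡c = ⊥-elim (r∉W (subst (_∈ W) (α-injective αy≡αr) y∈))
      where
      αy≡αr : α y ≡ α r
      αy≡αr = trans (trans (cong α (lookup-index y∈)) αy≡c) (sym αr≡c)

    α-cluster : ∀ {y z} → y ∈ W → z ∈ W → y ∙ z ∣ r → (A ∩ S c (α y)) (α z)
    α-cluster y∈ z∈ yz∣r =
      α-into-A z∈ , A∌c _ (α-into-A z∈) , subst (λ x → C x _ _) αr≡c (α-preservesC _ _ _ yz∣r)

    α-cluster-self : ∀ {y} → y ∈ W → (A ∩ S c (α y)) (α y)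
    α-cluster-self y∈ = α-into-A y∈ , A∌c _ (α-into-A y∈) , C-diag (A∌c _ (α-into-A y∈) ∘ sym)

    gc≡gαr : g c ≡ g (α r)
    gc≡gαr = cong g (sym αr≡c)

    branches : ∀ {y z} → y ∈ W → z ∈ W → y ∙ z ∣ r → g (α y) ∙ g (α z) ∣ g (α r)
    branches {y} {z} y∈ z∈ yz∣r = subst (λ x → C x (g (α y)) (g (α z))) gc≡gαr
      (proj₂ (rer₁ _ (α-into-A y∈)) _ _ _
        (_ , α-cluster-self y∈ , refl) (_ , α-cluster y∈ z∈ yz∣r , refl) (c , refl , refl))

    within : ∀ {y z w} → y ∈ W → z ∈ W → w ∈ W →
             y ∙ z ∣ r → y ∙ w ∣ r → z ∙ w ∣ y → g (α z) ∙ g (α w) ∣ g (α y)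
    within y∈ z∈ w∈ yz∣r yw∣r zw∣y = rer₂ _ (α-into-A y∈) _ _ _
      (α-cluster-self y∈) (α-cluster y∈ z∈ yz∣r) (α-cluster y∈ w∈ yw∣r) (α-preservesC _ _ _ zw∣y)

    reverses : ReversesDepth r (g (α r)) W (g ∘ α)
    reverses {y} {z} y∈ z∈ zr∣y = subst (C (g (α z)) (g (α y))) gc≡gαr
      (rer₄ _ _ (α-into-A y∈) (α-into-A z∈) (subst (C _ _) αr≡c (α-preservesC _ _ _ zr∣y)))

  rer-splitOff : ∀ x W → x ∉ W → Σ (L → L) λ G → Generated G × SplitsOff x W G
  rer-splitOff x W x∉W =
    let e₁ , e₁-generated , φ₁ , reverses₁ = rer-pivot x W x∉W
        p , p≢e₁x , p-sibling = sibling-exists (e₁ x) (map e₁ W) (pivot-∉ φ₁ x∉W)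
        e₂ , e₂-generated , φ₂ , reverses₂ = rer-pivot p (e₁ x ∷ map e₁ W) (sibling-∉ p≢e₁x p-sibling)
    in e₂ ∘ e₁ , comp e₂-generated e₁-generated ,
       twoReversals-splitOff x∉W φ₁ reverses₁ p-sibling φ₂ reverses₂

  rer-comb : ∀ P vs → AllPairs _≺_ vs → (∀ {v} → v ∈ vs → v ∈ P) →
            Σ (L → L) λ F → Generated F × InjectiveOn P F × Comb vs F
  rer-comb P [] _ _ = id , id-generated , (λ _ _ → id) , λ ()
  rer-comb P (v ∷ vs) (v≺vs ∷ vs-sorted) v∷vs⊆P =
    let F , F-generated , F-injective , F-comb = rer-comb P vs vs-sorted (v∷vs⊆P ∘ there)
        G , G-generated , G-splitsOff = rer-splitOff (F v) (map F (remove v P))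
                                          (injectiveOn⇒∉-remove F-injective (v∷vs⊆P (here refl)))
    in G ∘ F , comp G-generated F-generated ,
       comb-extend v≺vs (v∷vs⊆P ∘ there) F-injective F-comb G-splitsOff

mainTheorem17 : (𝕃 : LStructure) (c : LStructure.L 𝕃) (A : LStructure.L 𝕃 → Set) →
    (∀ a → A a → a ≢ c) → Notions.Universal 𝕃 c A →
    (g : LStructure.L 𝕃 → LStructure.L 𝕃) → Notions.BehavesRer 𝕃 c g A →
    (h : LStructure.L 𝕃 → LStructure.L 𝕃) →
    Notions.Preserves≺ 𝕃 h → Notions.BehavesLin 𝕃 h →
    Notions.Generates 𝕃 (Notions.GAut 𝕃 g) h
mainTheorem17 𝕃 c A A∌c universal g rer h h-mono h-lin n A′ =
  let vs = sortedNub (tabulate A′)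
      vs-sorted = sortedNub-strict (tabulate A′)
      F , F-generated , _ , F-comb = rer-comb vs vs vs-sorted id
      h-comb = lin⇒comb {vs} h-mono h-lin
      β , β-aut , β∘F≡h = homogeneous-on (AllPairs.map ≺⇒≢ vs-sorted)
        (comb⇒injectiveOn F-comb) (comb⇒injectiveOn h-comb)
        (λ y∈ z∈ w∈ → ⇔.trans (comb-pattern F-comb y∈ z∈ w∈) (⇔.sym (comb-pattern h-comb y∈ z∈ w∈)))
  in β ∘ F , comp (gen (inj₂ β-aut)) F-generated , λ i → β∘F≡h (∈-sortedNub (∈-tabulate⁺ i))
  where
  open Notions 𝕃 using (comp; gen)
  open Properties 𝕃
  open RerGenerators 𝕃 c A A∌c universal g rer
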